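{- Let $n,r$ be positive integers, let $m$ be an integer with $[m-1]\subseteq[n]$, and let $a_1,\ldots,a_j\in[m-1]$. Then \[\mathbb{E}_{\mathfrak{S}_{n,r}}[X_{a_1}\cdots X_{a_j}X_{m+1}X_{m+2}\cdots X_n]=\mathbb{E}_{\mathfrak{S}_{n,r}}[X_{a_1}\cdots X_{a_j}]\cdot\mathbb{E}_{\mathfrak{S}_{n,r}}[X_{m+1}X_{m+2}\cdots X_n].\]
   Context: $\mathfrak{S}_{n,r}$ is the set of pairs $(\omega,\tau)$, $\omega\in\mathfrak{S}_n$, $\tau:[n]\to\mathbb{Z}_r$ (colors $0,\ldots,r-1$). Order symbols $i^c$ by $1^0<\cdots<n^0<1^1<\cdots<n^1<\cdots<1^{r-1}<\cdots<n^{r-1}$. An index $i\in[n]$ is a descent of $(\omega,\tau)$ if $\omega(i)^{\tau(i)}>\omega(i+1)^{\tau(i+1)}$, with the convention $\omega(n+1)=n+1$, $\tau(n+1)=0$. $X_i$ is the indicator that $i$ is a descent; indices $a_i$ need not be distinct. Expectations are with respect to the uniform distribution on $\mathfrak{S}_{n,r}$. -}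

module Defs where

open import Data.Nat using (ℕ; zero; suc; _+_; _*_; _∸_; _<_; _≤_; _<?_; _≤?_)
open import Data.Nat.Properties using (_≟_)
open import Data.Fin using (Fin; toℕ)
import Data.Fin
import Data.Fin.Properties
open import Data.List using (List; []; _∷_; map; concatMap; filterᵇ; length; allFin)
open import Data.List.Relation.Unary.All using () renaming (all? to allL?)
open import Data.Product using (_×_; _,_; proj₁; proj₂)
open import Data.Sum using (_⊎_)
open import Data.Bool using (Bool)
open import Data.Integer using (+_)
open import Data.Rational using (ℚ; _/_; 0ℚ)
open import Data.Vec.Functional using (Vector) renaming (_∷_ to _∷ᵛ_)
open import Relation.Binary.PropositionalEquality using (_≡_)
open import Relation.Nullary using (Dec; yes; no; _×-dec_; _⊎-dec_; _→-dec_)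
open import Relation.Nullary.Decidable using (⌊_⌋)

allFuns : (n k : ℕ) → List (Fin n → Fin k)
allFuns zero    k = (λ ()) ∷ []
allFuns (suc n) k = concatMap (λ f → map (λ x → x ∷ᵛ f) (allFin k)) (allFuns n k)

injective? : {n : ℕ} (ω : Fin n → Fin n) →
             Dec (∀ i j → toℕ (ω i) ≡ toℕ (ω j) → toℕ i ≡ toℕ j)
injective? ω = Data.Fin.Properties.all? (λ i → Data.Fin.Properties.all? (λ j →
                 (toℕ (ω i) ≟ toℕ (ω j)) →-dec (toℕ i ≟ toℕ j)))

-- 𝔖_n : all permutations of [n] (0-based: Fin n → Fin n, injective).
perms : (n : ℕ) → List (Fin n → Fin n)
perms n = filterᵇ (λ ω → ⌊ injective? ω ⌋) (allFuns n n)

-- Colored permutations (ω , τ) ∈ 𝔖_{n,r}, τ : [n] → ℤ_r (colors 0..r-1).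
ColPerm : ℕ → ℕ → Set
ColPerm n r = (Fin n → Fin n) × (Fin n → Fin r)

Snr : (n r : ℕ) → List (ColPerm n r)
Snr n r = concatMap (λ ω → map (λ τ → (ω , τ)) (allFuns n r)) (perms n)

-- A symbol i^c encoded as (c , i) : color, value (values 1..n+1).
Symbol : Set
Symbol = ℕ × ℕ

-- Order 1^0 < ... < n^0 < 1^1 < ... : lexicographic on (color, value).
_<ˢ_ : Symbol → Symbol → Set
(c , a) <ˢ (d , b) = (c < d) ⊎ ((c ≡ d) × (a < b))

_<ˢ?_ : (x y : Symbol) → Dec (x <ˢ y)
(c , a) <ˢ? (d , b) = (c <? d) ⊎-dec ((c ≟ d) ×-dec (a <? b))

-- The symbol ω(i)^{τ(i)} at 1-based position i ∈ [n], with the convention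
-- ω(n+1) = n+1, τ(n+1) = 0 (used for every position outside [n]).
symAt : {n r : ℕ} → ColPerm n r → ℕ → Symbol
symAt {n} (ω , τ) i with i ≤? n
... | no  _ = (0 , suc n)
symAt {n} (ω , τ) zero    | yes _ = (0 , suc n)
symAt {n} (ω , τ) (suc k) | yes k<n =
  (toℕ (τ (Data.Fin.fromℕ< k<n)) , suc (toℕ (ω (Data.Fin.fromℕ< k<n))))

IsDescent : {n r : ℕ} → ColPerm n r → ℕ → Set
IsDescent σ i = symAt σ (suc i) <ˢ symAt σ i

isDescent? : {n r : ℕ} (σ : ColPerm n r) (i : ℕ) → Dec (IsDescent σ i)
isDescent? σ i = symAt σ (suc i) <ˢ? symAt σ i

-- The random variable X_{b_1} ⋯ X_{b_k} (a product of indicators) is the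
-- indicator that every b_l is a descent; it is evaluated as a Boolean.
allDescents : {n r : ℕ} → List ℕ → ColPerm n r → Bool
allDescents is σ = ⌊ allL? (isDescent? σ) is ⌋

ratio : ℕ → ℕ → ℚ
ratio k zero    = 0ℚ
ratio k (suc N) = + k / suc N

E : (n r : ℕ) → List ℕ → ℚ
E n r is = ratio (length (filterᵇ (allDescents is) (Snr n r))) (length (Snr n r))

range : ℕ → ℕ → List ℕ
range m n = go (n ∸ m) (suc m)
  where
  go : ℕ → ℕ → List ℕ
  go zero    s = []
  go (suc k) s = s ∷ go k (suc s)

module Submission where

-- The descents at a₁, …, a_j < m only look at the letters in positions 1, …, m, while X_{m+1} ⋯ X_n says that
-- the letters in positions m+1, …, n strictly decrease and all lie above the sentinel (n+1)^0, i.e. all have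
-- non-zero colour.  Let G be the maps that rearrange the letters in positions m+1, …, n in every possible way and
-- independently swap each of their colours c with 0.  Every g ∈ G permutes 𝔖_{n,r} and leaves the first event
-- unchanged, and for every σ exactly (r-1)^{n-m} of the gσ satisfy the tail event: one rearrangement sorts the
-- letters, and r - 1 of the r colour swaps at each position give a non-zero colour.  Summing over σ and g gives,
-- for the two events A and B, |G|·#(A ∩ B) = (r-1)^{n-m}·#A and |G|·#B = (r-1)^{n-m}·|𝔖_{n,r}|, hence
-- #(A ∩ B)·|𝔖_{n,r}| = #A·#B.

open import Defs

open import Data.Bool using (T; T?)
open import Data.Empty using (⊥; ⊥-elim)
open import Data.Fin using (Fin; toℕ; fromℕ<) renaming (zero to fzero; suc to fsuc)
import Data.Fin.Properties as Fin
open import Data.Fin.Permutation.Components using (transpose)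
import Data.Integer as ℤ
import Data.Integer.Properties as ℤ
open import Data.List using (List; []; _∷_; _++_; map; concatMap; filterᵇ; length; allFin; cartesianProductWith)
open import Data.List.Properties using (length-++; length-map; length-tabulate)
open import Data.List.Membership.Propositional using (_∈_; find)
open import Data.List.Membership.Propositional.Properties
  using (∈-allFin; ∈-filter⁻; ∈-map⁻; ∈-cartesianProductWith⁻)
import Data.List.Membership.Setoid as SetoidMembership
import Data.List.Membership.Setoid.Properties as SetoidMembershipₚ
open import Data.List.Relation.Unary.Any using (here; there)
open import Data.List.Relation.Unary.All as All using (All; []; _∷_)
import Data.List.Relation.Unary.All.Properties as Allₚ
open import Data.List.Relation.Unary.AllPairs using ([]; _∷_)
open import Data.List.Relation.Unary.Unique.Propositional using (Unique)
open import Data.List.Relation.Unary.Unique.Propositional.Properties using (allFin⁺; Unique[x∷xs]⇒x∉xs)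
import Data.List.Relation.Unary.Unique.Setoid as SetoidUnique
import Data.List.Relation.Unary.Unique.Setoid.Properties as SetoidUniqueₚ
open import Data.Nat using (ℕ; zero; suc; _+_; _*_; _^_; _∸_; _<_; _≤_; z≤n; s≤s; z<s; pred; NonZero; _≤?_; _<?_)
open import Data.Nat.Properties
open import Data.Nat.Tactic.RingSolver using (solve-∀)
open import Data.Product using (∃; _×_; _,_; proj₁; proj₂)
open import Data.Product.Properties using (×-≡,≡→≡)
open import Data.Product.Relation.Binary.Lex.Strict using (×-isStrictTotalOrder)
open import Data.Product.Relation.Binary.Pointwise.NonDependent using (×-setoid; Pointwise)
import Data.Rational as ℚ
import Data.Rational.Properties as ℚ
open import Data.Rational.Unnormalised using (mkℚᵘ; *≡*)
import Data.Rational.Unnormalised as ℚᵘ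
import Data.Rational.Unnormalised.Properties as ℚᵘ
open import Data.Sum using (_⊎_; inj₁; inj₂)
open import Data.Unit using (⊤; tt)
open import Data.Vec.Functional using (updateAt) renaming (_∷_ to _∷ᵛ_)
open import Data.Vec.Functional.Properties
  using (updateAt-updates; updateAt-minimal; updateAt-updateAt-local; updateAt-id)
open import Function using (_∘_; id; _⇔_; mk⇔; Equivalence)
open import Function.Construct.Composition using (_⇔-∘_)
open import Function.Construct.Identity using (⇔-id)
open import Level using (0ℓ)
open import Relation.Binary.Bundles using (Setoid)
open import Relation.Binary.Core using (_Preserves_⟶_)
open import Relation.Binary.Definitions using (Decidable; tri<; tri≈; tri>)
open import Relation.Binary.PropositionalEquality
open import Relation.Binary.Structures using (IsStrictTotalOrder)
open import Relation.Nullary using (¬_; Dec; yes; no; _×-dec_; ¬?)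
open import Relation.Nullary.Decidable using (⌊_⌋; toWitness; fromWitness)

sumBy : {A : Set} → List A → (A → ℕ) → ℕ
sumBy []       f = 0
sumBy (x ∷ xs) f = f x + sumBy xs f

module _ {A : Set} where

  sumBy-++ : (xs ys : List A) (f : A → ℕ) → sumBy (xs ++ ys) f ≡ sumBy xs f + sumBy ys f
  sumBy-++ []       ys f = refl
  sumBy-++ (x ∷ xs) ys f = trans (cong (f x +_) (sumBy-++ xs ys f)) (sym (+-assoc (f x) _ _))

  sumBy-cong : (xs : List A) {f g : A → ℕ} → (∀ {x} → x ∈ xs → f x ≡ g x) → sumBy xs f ≡ sumBy xs g
  sumBy-cong []       f≡g = refl
  sumBy-cong (x ∷ xs) f≡g = cong₂ _+_ (f≡g (here refl)) (sumBy-cong xs (f≡g ∘ there))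

  sumBy-+ : (xs : List A) (f g : A → ℕ) → sumBy xs (λ x → f x + g x) ≡ sumBy xs f + sumBy xs g
  sumBy-+ []       f g = refl
  sumBy-+ (x ∷ xs) f g = trans (cong (f x + g x +_) (sumBy-+ xs f g)) (interchange (f x) (g x) _ _)
    where
    interchange : ∀ a b c d → (a + b) + (c + d) ≡ (a + c) + (b + d)
    interchange = solve-∀

  sumBy-*ˡ : (xs : List A) (k : ℕ) (f : A → ℕ) → sumBy xs (λ x → k * f x) ≡ k * sumBy xs f
  sumBy-*ˡ []       k f = sym (*-zeroʳ k)
  sumBy-*ˡ (x ∷ xs) k f = trans (cong (k * f x +_) (sumBy-*ˡ xs k f)) (sym (*-distribˡ-+ k (f x) _))

  sumBy-const : (xs : List A) (k : ℕ) → sumBy xs (λ _ → k) ≡ length xs * k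
  sumBy-const []       k = refl
  sumBy-const (x ∷ xs) k = cong (k +_) (sumBy-const xs k)

  sumBy-zero : (xs : List A) {f : A → ℕ} → (∀ {x} → x ∈ xs → f x ≡ 0) → sumBy xs f ≡ 0
  sumBy-zero xs f≡0 = trans (sumBy-cong xs f≡0) (trans (sumBy-const xs 0) (*-zeroʳ (length xs)))

module _ {A B : Set} where

  sumBy-map : (g : A → B) (xs : List A) (f : B → ℕ) → sumBy (map g xs) f ≡ sumBy xs (f ∘ g)
  sumBy-map g []       f = refl
  sumBy-map g (x ∷ xs) f = cong (f (g x) +_) (sumBy-map g xs f)

  sumBy-comm : (xs : List A) (ys : List B) (f : A → B → ℕ) →
               sumBy xs (λ x → sumBy ys (f x)) ≡ sumBy ys (λ y → sumBy xs (λ x → f x y))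
  sumBy-comm []       ys f = sym (sumBy-zero ys (λ _ → refl))
  sumBy-comm (x ∷ xs) ys f =
    trans (cong (sumBy ys (f x) +_) (sumBy-comm xs ys f)) (sym (sumBy-+ ys (f x) _))

module _ {A B C : Set} (h : A → B → C) where

  sumBy-cartesianProductWith : (xs : List A) (ys : List B) (f : C → ℕ) →
    sumBy (cartesianProductWith h xs ys) f ≡ sumBy xs (λ x → sumBy ys (f ∘ h x))
  sumBy-cartesianProductWith []       ys f = refl
  sumBy-cartesianProductWith (x ∷ xs) ys f = begin
    sumBy (map (h x) ys ++ cartesianProductWith h xs ys) f
      ≡⟨ sumBy-++ (map (h x) ys) _ f ⟩
    sumBy (map (h x) ys) f + sumBy (cartesianProductWith h xs ys) f
      ≡⟨ cong₂ _+_ (sumBy-map (h x) ys f) (sumBy-cartesianProductWith xs ys f) ⟩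
    sumBy ys (f ∘ h x) + sumBy xs (λ x → sumBy ys (f ∘ h x))  ∎
    where open ≡-Reasoning

  length-cartesianProductWith : (xs : List A) (ys : List B) →
    length (cartesianProductWith h xs ys) ≡ length xs * length ys
  length-cartesianProductWith []       ys = refl
  length-cartesianProductWith (x ∷ xs) ys = begin
    length (map (h x) ys ++ cartesianProductWith h xs ys)
      ≡⟨ length-++ (map (h x) ys) ⟩
    length (map (h x) ys) + length (cartesianProductWith h xs ys)
      ≡⟨ cong₂ _+_ (length-map (h x) ys) (length-cartesianProductWith xs ys) ⟩
    length ys + length xs * length ys  ∎
    where open ≡-Reasoning

  concatMap-map≡cartesianProductWith : (xs : List A) (ys : List B) →
    concatMap (λ x → map (h x) ys) xs ≡ cartesianProductWith h xs ys
  concatMap-map≡cartesianProductWith []       ys = refl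
  concatMap-map≡cartesianProductWith (x ∷ xs) ys =
    cong (map (h x) ys ++_) (concatMap-map≡cartesianProductWith xs ys)

indicator : {P : Set} → Dec P → ℕ
indicator (yes _) = 1
indicator (no _)  = 0

module _ {P Q : Set} where

  indicator-cong : (p? : Dec P) (q? : Dec Q) → P ⇔ Q → indicator p? ≡ indicator q?
  indicator-cong (yes p) (yes q) P⇔Q = refl
  indicator-cong (yes p) (no ¬q) P⇔Q = ⊥-elim (¬q (Equivalence.to P⇔Q p))
  indicator-cong (no ¬p) (yes q) P⇔Q = ⊥-elim (¬p (Equivalence.from P⇔Q q))
  indicator-cong (no ¬p) (no ¬q) P⇔Q = refl

  indicator-× : (p? : Dec P) (q? : Dec Q) → indicator (p? ×-dec q?) ≡ indicator p? * indicator q?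
  indicator-× (yes p) (yes q) = refl
  indicator-× (yes p) (no ¬q) = refl
  indicator-× (no ¬p) q?      = refl

  indicator-*-≡0 : (p? : Dec P) (q? : Dec Q) → (P → Q → ⊥) → indicator p? * indicator q? ≡ 0
  indicator-*-≡0 (yes p) (yes q) ¬p×q = ⊥-elim (¬p×q p q)
  indicator-*-≡0 (yes _) (no _)  _    = refl
  indicator-*-≡0 (no _)  _       _    = refl

module _ {P : Set} where

  indicator-yes : (p? : Dec P) → P → indicator p? ≡ 1
  indicator-yes (yes _) _ = refl
  indicator-yes (no ¬p) p = ⊥-elim (¬p p)

  indicator-no : (p? : Dec P) → ¬ P → indicator p? ≡ 0
  indicator-no (yes p) ¬p = ⊥-elim (¬p p)
  indicator-no (no _)  _  = refl

  indicator-+-¬ : (p? : Dec P) → indicator p? + indicator (¬? p?) ≡ 1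
  indicator-+-¬ (yes _) = refl
  indicator-+-¬ (no _)  = refl

length-filterᵇ-⌊⌋ : {A : Set} {P : A → Set} (P? : ∀ x → Dec (P x)) (xs : List A) →
  length (filterᵇ (λ x → ⌊ P? x ⌋) xs) ≡ sumBy xs (λ x → indicator (P? x))
length-filterᵇ-⌊⌋ P? []       = refl
length-filterᵇ-⌊⌋ P? (x ∷ xs) with P? x
... | yes _ = cong suc (length-filterᵇ-⌊⌋ P? xs)
... | no  _ = length-filterᵇ-⌊⌋ P? xs

module DuplicateFreeSums (S : Setoid 0ℓ 0ℓ) where

  open Setoid S renaming (Carrier to A; refl to ≈-refl; sym to ≈-sym; trans to ≈-trans)
  open SetoidMembership S using () renaming (_∈_ to _∈≈_)
  open SetoidUnique S using () renaming (Unique to Unique≈)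

  sumBy-indicator-unique : {P : A → Set} (P? : ∀ x → Dec (P x)) {xs : List A} → Unique≈ xs →
    ∀ {x₀} → x₀ ∈ xs → P x₀ → (∀ {y} → y ∈ xs → P y → y ≈ x₀) →
    sumBy xs (λ x → indicator (P? x)) ≡ 1
  sumBy-indicator-unique P? {x ∷ xs} (x≉xs ∷ xs!) (here refl) Px only =
    cong₂ _+_ (indicator-yes (P? x) Px)
      (sumBy-zero xs (λ y∈ → indicator-no (P? _) (λ Py → All.lookup x≉xs y∈ (≈-sym (only (there y∈) Py)))))
  sumBy-indicator-unique P? {x ∷ xs} (x≉xs ∷ xs!) (there x₀∈) Px₀ only =
    cong₂ _+_ (indicator-no (P? x) (λ Px → All.lookup x≉xs x₀∈ (only (here refl) Px)))
      (sumBy-indicator-unique P? xs! x₀∈ Px₀ (only ∘ there))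

  -- Both sides equal the sum of f x over the pairs x ≈ y, since every element has exactly one partner.
  sumBy-sameElements : Decidable _≈_ → {xs ys : List A} → Unique≈ xs → Unique≈ ys →
    (∀ {x} → x ∈ xs → x ∈≈ ys) → (∀ {y} → y ∈ ys → y ∈≈ xs) →
    (f : A → ℕ) → f Preserves _≈_ ⟶ _≡_ → sumBy xs f ≡ sumBy ys f
  sumBy-sameElements _≈?_ {xs} {ys} xs! ys! xs⊆ys ys⊆xs f f-resp = begin
    sumBy xs f
      ≡⟨ sumBy-cong xs (λ x∈ → weigh-by-1 (count-ys x∈)) ⟩
    sumBy xs (λ x → f x * sumBy ys (δ x))
      ≡⟨ sumBy-cong xs (λ {x} _ → sym (sumBy-*ˡ ys (f x) (δ x))) ⟩
    sumBy xs (λ x → sumBy ys (λ y → f x * δ x y))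
      ≡⟨ sumBy-comm xs ys (λ x y → f x * δ x y) ⟩
    sumBy ys (λ y → sumBy xs (λ x → f x * δ x y))
      ≡⟨ sumBy-cong ys (λ {y} _ → sumBy-cong xs (λ {x} _ → weight-resp x y)) ⟩
    sumBy ys (λ y → sumBy xs (λ x → f y * δ x y))
      ≡⟨ sumBy-cong ys (λ {y} _ → sumBy-*ˡ xs (f y) (λ x → δ x y)) ⟩
    sumBy ys (λ y → f y * sumBy xs (λ x → δ x y))
      ≡⟨ sumBy-cong ys (λ y∈ → sym (weigh-by-1 (count-xs y∈))) ⟩
    sumBy ys f  ∎
    where
    open ≡-Reasoning
    δ : A → A → ℕ
    δ x y = indicator (x ≈? y)

    weigh-by-1 : ∀ {a k} → k ≡ 1 → a ≡ a * k
    weigh-by-1 {a} refl = sym (*-identityʳ a)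

    weight-resp : ∀ x y → f x * δ x y ≡ f y * δ x y
    weight-resp x y with x ≈? y
    ... | yes x≈y = cong (_* 1) (f-resp x≈y)
    ... | no  _   = trans (*-zeroʳ (f x)) (sym (*-zeroʳ (f y)))

    count-ys : ∀ {x} → x ∈ xs → sumBy ys (δ x) ≡ 1
    count-ys x∈ with find (xs⊆ys x∈)
    ... | y₀ , y₀∈ , x≈y₀ =
      sumBy-indicator-unique (_ ≈?_) ys! y₀∈ x≈y₀ (λ _ x≈y → ≈-trans (≈-sym x≈y) x≈y₀)

    count-xs : ∀ {y} → y ∈ ys → sumBy xs (λ x → δ x y) ≡ 1
    count-xs y∈ with find (ys⊆xs y∈)
    ... | x₀ , x₀∈ , y≈x₀ =
      sumBy-indicator-unique (_≈? _) xs! x₀∈ (≈-sym y≈x₀) (λ _ x≈y → ≈-trans x≈y y≈x₀)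

sumBy-allFin-≢ : ∀ k (x : Fin (suc k)) → sumBy (allFin (suc k)) (λ c → indicator (¬? (c Fin.≟ x))) ≡ k
sumBy-allFin-≢ k x = +-cancelˡ-≡ 1 _ _ (begin
  1 + sumBy cs ≢x                        ≡⟨ cong (_+ sumBy cs ≢x) (sym exactly-one) ⟩
  sumBy cs ≡x + sumBy cs ≢x              ≡⟨ sym (sumBy-+ cs ≡x ≢x) ⟩
  sumBy cs (λ c → ≡x c + ≢x c)           ≡⟨ sumBy-cong cs (λ {c} _ → indicator-+-¬ (c Fin.≟ x)) ⟩
  sumBy cs (λ _ → 1)                     ≡⟨ trans (sumBy-const cs 1) (trans (*-identityʳ _) (length-tabulate id)) ⟩
  suc k                                  ∎)
  where
  open ≡-Reasoning
  cs : List (Fin (suc k))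
  cs = allFin (suc k)
  ≡x ≢x : Fin (suc k) → ℕ
  ≡x c = indicator (c Fin.≟ x)
  ≢x c = indicator (¬? (c Fin.≟ x))
  exactly-one : sumBy cs ≡x ≡ 1
  exactly-one = DuplicateFreeSums.sumBy-indicator-unique (setoid (Fin (suc k))) (Fin._≟ x) (allFin⁺ (suc k))
    (∈-allFin x) refl (λ _ c≡x → c≡x)

-- Independence by averaging

module Averaging {X : Set} (_≈_ : X → X → Set) (space : List X) where

  SumPreserving : (X → X) → Set
  SumPreserving g = ∀ f → f Preserves _≈_ ⟶ _≡_ → sumBy space (f ∘ g) ≡ sumBy space f

  module _ (moves : List (X → X)) (preserving : ∀ {g} → g ∈ moves → SumPreserving g)
           (q : X → ℕ) (q-resp : q Preserves _≈_ ⟶ _≡_)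
           (K : ℕ) (orbit-count : ∀ {x} → x ∈ space → sumBy moves (λ g → q (g x)) ≡ K) where

    orbit-double-count : (p : X → ℕ) → p Preserves _≈_ ⟶ _≡_ → (∀ {g} → g ∈ moves → ∀ x → p (g x) ≡ p x) →
      length moves * sumBy space (λ x → p x * q x) ≡ K * sumBy space p
    orbit-double-count p p-resp p-invariant = begin
      length moves * sumBy space (λ x → p x * q x)
        ≡⟨ sym (sumBy-const moves _) ⟩
      sumBy moves (λ g → sumBy space (λ x → p x * q x))
        ≡⟨ sumBy-cong moves (λ g∈ → sym (moved g∈)) ⟩
      sumBy moves (λ g → sumBy space (λ x → p x * q (g x)))
        ≡⟨ sym (sumBy-comm space moves _) ⟩
      sumBy space (λ x → sumBy moves (λ g → p x * q (g x)))
        ≡⟨ sumBy-cong space (λ {x} _ → sumBy-*ˡ moves (p x) _) ⟩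
      sumBy space (λ x → p x * sumBy moves (λ g → q (g x)))
        ≡⟨ sumBy-cong space (λ {x} x∈ → cong (p x *_) (orbit-count x∈)) ⟩
      sumBy space (λ x → p x * K)
        ≡⟨ sumBy-cong space (λ {x} _ → *-comm (p x) K) ⟩
      sumBy space (λ x → K * p x)
        ≡⟨ sumBy-*ˡ space K p ⟩
      K * sumBy space p  ∎
      where
      open ≡-Reasoning
      moved : ∀ {g} → g ∈ moves → sumBy space (λ x → p x * q (g x)) ≡ sumBy space (λ x → p x * q x)
      moved {g} g∈ = trans (sumBy-cong space (λ {x} _ → cong (_* q (g x)) (sym (p-invariant g∈ x))))
                           (preserving g∈ (λ x → p x * q x) (λ x≈y → cong₂ _*_ (p-resp x≈y) (q-resp x≈y)))

    independent-by-averaging : .{{NonZero (length moves)}} →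
      (p : X → ℕ) → p Preserves _≈_ ⟶ _≡_ → (∀ {g} → g ∈ moves → ∀ x → p (g x) ≡ p x) →
      sumBy space (λ x → p x * q x) * length space ≡ sumBy space p * sumBy space q
    independent-by-averaging p p-resp p-invariant = *-cancelˡ-≡ _ _ L (begin
      L * (C * N)   ≡⟨ sym (*-assoc L C N) ⟩
      (L * C) * N   ≡⟨ cong (_* N) (orbit-double-count p p-resp p-invariant) ⟩
      (K * A) * N   ≡⟨ trans (cong (_* N) (*-comm K A)) (*-assoc A K N) ⟩
      A * (K * N)   ≡⟨ cong (A *_) (sym unweighted) ⟩
      A * (L * B)   ≡⟨ left-comm A L B ⟩
      L * (A * B)   ∎)
      where
      open ≡-Reasoning
      L N A B C : ℕ
      L = length moves
      N = length space
      A = sumBy space p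
      B = sumBy space q
      C = sumBy space (λ x → p x * q x)
      left-comm : ∀ a b c → a * (b * c) ≡ b * (a * c)
      left-comm = solve-∀
      unweighted : L * B ≡ K * N
      unweighted = begin
        L * B                               ≡⟨ cong (L *_) (sumBy-cong space (λ {x} _ → sym (+-identityʳ (q x)))) ⟩
        L * sumBy space (λ x → 1 * q x)     ≡⟨ orbit-double-count (λ _ → 1) (λ _ → refl) (λ _ _ → refl) ⟩
        K * sumBy space (λ _ → 1)           ≡⟨ cong (K *_) (trans (sumBy-const space 1) (*-identityʳ N)) ⟩
        K * N                               ∎

module _ {n : ℕ} (i j : Fin n) where

  transpose-matchˡ : transpose i j i ≡ j
  transpose-matchˡ with i Fin.≟ i
  ... | yes _   = refl
  ... | no  i≢i = ⊥-elim (i≢i refl)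

  transpose-matchʳ : transpose i j j ≡ i
  transpose-matchʳ with j Fin.≟ i
  ... | yes j≡i = j≡i
  ... | no  _ with j Fin.≟ j
  ...   | yes _   = refl
  ...   | no  j≢j = ⊥-elim (j≢j refl)

  transpose-other : ∀ {k} → k ≢ i → k ≢ j → transpose i j k ≡ k
  transpose-other {k} k≢i k≢j with k Fin.≟ i
  ... | yes k≡i = ⊥-elim (k≢i k≡i)
  ... | no  _ with k Fin.≟ j
  ...   | yes k≡j = ⊥-elim (k≢j k≡j)
  ...   | no  _   = refl

  transpose-involutive : ∀ k → transpose i j (transpose i j k) ≡ k
  transpose-involutive k = by-cases (k Fin.≟ i) (k Fin.≟ j)
    where
    by-cases : Dec (k ≡ i) → Dec (k ≡ j) → transpose i j (transpose i j k) ≡ k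
    by-cases (yes k≡i) _ rewrite k≡i = trans (cong (transpose i j) transpose-matchˡ) transpose-matchʳ
    by-cases (no _) (yes k≡j) rewrite k≡j = trans (cong (transpose i j) transpose-matchʳ) transpose-matchˡ
    by-cases (no k≢i) (no k≢j) = trans (cong (transpose i j) (transpose-other k≢i k≢j)) (transpose-other k≢i k≢j)

  transpose-injective : ∀ {k l} → transpose i j k ≡ transpose i j l → k ≡ l
  transpose-injective {k} {l} eq =
    trans (sym (transpose-involutive k)) (trans (cong (transpose i j) eq) (transpose-involutive l))

  transpose≡ʳ⇒≡ˡ : ∀ {k} → transpose i j k ≡ j → k ≡ i
  transpose≡ʳ⇒≡ˡ eq = transpose-injective (trans eq (sym transpose-matchˡ))

  transpose≡ˡ⇒≡ʳ : ∀ {k} → transpose i j k ≡ i → k ≡ j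
  transpose≡ˡ⇒≡ʳ eq = transpose-injective (trans eq (sym transpose-matchʳ))

  ∈-transpose : ∀ {k} {xs : List (Fin n)} → i ∈ xs → j ∈ xs → k ∈ xs → transpose i j k ∈ xs
  ∈-transpose {k} i∈ j∈ k∈ = by-cases (k Fin.≟ i) (k Fin.≟ j)
    where
    by-cases : Dec (k ≡ i) → Dec (k ≡ j) → transpose i j k ∈ _
    by-cases (yes k≡i) _ rewrite k≡i = subst (_∈ _) (sym transpose-matchˡ) j∈
    by-cases (no _) (yes k≡j) rewrite k≡j = subst (_∈ _) (sym transpose-matchʳ) i∈
    by-cases (no k≢i) (no k≢j) = subst (_∈ _) (sym (transpose-other k≢i k≢j)) k∈

updateAt-congˡ : {A : Set} {n : ℕ} (p : Fin n) (f : A → A) {xs ys : Fin n → A} →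
  (∀ i → xs i ≡ ys i) → ∀ i → updateAt xs p f i ≡ updateAt ys p f i
updateAt-congˡ p f {xs} {ys} xs≗ys i with i Fin.≟ p
... | yes refl = trans (updateAt-updates i xs) (trans (cong f (xs≗ys i)) (sym (updateAt-updates i ys)))
... | no  i≢p  = trans (updateAt-minimal i p xs i≢p) (trans (xs≗ys i) (sym (updateAt-minimal i p ys i≢p)))

<ˢ-isStrictTotalOrder : IsStrictTotalOrder (Pointwise _≡_ _≡_) _<ˢ_
<ˢ-isStrictTotalOrder = ×-isStrictTotalOrder <-isStrictTotalOrder <-isStrictTotalOrder

open IsStrictTotalOrder <ˢ-isStrictTotalOrder using () renaming (trans to <ˢ-trans; asym to <ˢ-asym; compare to <ˢ-compare)

maximum-exists : {A : Set} (f : A → Symbol) (q : A) (qs : List A) →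
  ∃ λ p → p ∈ q ∷ qs × (∀ {x} → x ∈ q ∷ qs → f x ≡ f p ⊎ f x <ˢ f p)
maximum-exists f q []        = q , here refl , λ { (here refl) → inj₁ refl }
maximum-exists f q (q′ ∷ qs) with maximum-exists f q′ qs
... | p , p∈ , p-max with <ˢ-compare (f q) (f p)
...   | tri< fq<fp _ _ = p , there p∈ , λ { (here refl) → inj₂ fq<fp ; (there x∈) → p-max x∈ }
...   | tri≈ _ fq≈fp _ = p , there p∈ , λ { (here refl) → inj₁ (×-≡,≡→≡ fq≈fp) ; (there x∈) → p-max x∈ }
...   | tri> _ _ fp<fq = q , here refl , λ { (here refl) → inj₁ refl ; (there x∈) → inj₂ (≤ˢ-<ˢ-trans (p-max x∈) fp<fq) }
  where
  ≤ˢ-<ˢ-trans : ∀ {a b c} → a ≡ b ⊎ a <ˢ b → b <ˢ c → a <ˢ c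
  ≤ˢ-<ˢ-trans (inj₁ refl) b<c = b<c
  ≤ˢ-<ˢ-trans (inj₂ a<b)  b<c = <ˢ-trans a<b b<c

-- The sample space and its symmetries

allFuns-suc : ∀ n k → allFuns (suc n) k ≡ cartesianProductWith (λ f x → x ∷ᵛ f) (allFuns n k) (allFin k)
allFuns-suc n k = concatMap-map≡cartesianProductWith (λ f x → x ∷ᵛ f) (allFuns n k) (allFin k)

allFuns-unique : ∀ n k → SetoidUnique.Unique (Fin n →-setoid Fin k) (allFuns n k)
allFuns-unique zero    k = [] ∷ []
allFuns-unique (suc n) k = subst (SetoidUnique.Unique (Fin (suc n) →-setoid Fin k)) (sym (allFuns-suc n k))
  (SetoidUniqueₚ.cartesianProductWith⁺ (Fin n →-setoid Fin k) (setoid (Fin k)) (Fin (suc n) →-setoid Fin k) _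
    (λ x∷f≗y∷g → (x∷f≗y∷g ∘ fsuc) , x∷f≗y∷g fzero) (allFuns-unique n k) (allFin⁺ k))

∈-allFuns : ∀ n k (f : Fin n → Fin k) → SetoidMembership._∈_ (Fin n →-setoid Fin k) f (allFuns n k)
∈-allFuns zero    k f = here (λ ())
∈-allFuns (suc n) k f = subst (SetoidMembership._∈_ (Fin (suc n) →-setoid Fin k) f) (sym (allFuns-suc n k))
  (SetoidMembershipₚ.∈-resp-≈ (Fin (suc n) →-setoid Fin k) head∷tail
    (SetoidMembershipₚ.∈-cartesianProductWith⁺ (Fin n →-setoid Fin k) (setoid (Fin k)) (Fin (suc n) →-setoid Fin k)
      (λ f≗g x≡y → λ { fzero → x≡y ; (fsuc i) → f≗g i }) (∈-allFuns n k (f ∘ fsuc)) (∈-allFin (f fzero))))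
  where
  head∷tail : ∀ i → (f fzero ∷ᵛ (f ∘ fsuc)) i ≡ f i
  head∷tail fzero    = refl
  head∷tail (fsuc i) = refl

module ColouredPermutations (n r : ℕ) where

  CPₛ : Setoid 0ℓ 0ℓ
  CPₛ = ×-setoid (Fin n →-setoid Fin n) (Fin n →-setoid Fin r)

  open Setoid CPₛ public using (_≈_) renaming (sym to ≈-sym; trans to ≈-trans)
  open SetoidMembership CPₛ public using () renaming (_∈_ to _∈≈_)
  open SetoidUnique CPₛ public using () renaming (Unique to Unique≈)

  _≈?_ : Decidable _≈_
  (ω , τ) ≈? (ω′ , τ′) = Fin.all? (λ i → ω i Fin.≟ ω′ i) ×-dec Fin.all? (λ i → τ i Fin.≟ τ′ i)

  Valid : ColPerm n r → Set
  Valid σ = ∀ i j → toℕ (proj₁ σ i) ≡ toℕ (proj₁ σ j) → toℕ i ≡ toℕ j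

  Valid-resp : ∀ {σ σ′} → σ ≈ σ′ → Valid σ → Valid σ′
  Valid-resp (ω≗ω′ , _) inj i j eq = inj i j (trans (cong toℕ (ω≗ω′ i)) (trans eq (sym (cong toℕ (ω≗ω′ j)))))

  private
    isPerm? : (ω : Fin n → Fin n) → Dec (T ⌊ injective? ω ⌋)
    isPerm? ω = T? ⌊ injective? ω ⌋

    Snr≡ : Snr n r ≡ cartesianProductWith _,_ (perms n) (allFuns n r)
    Snr≡ = concatMap-map≡cartesianProductWith _,_ (perms n) (allFuns n r)

  Snr-unique : Unique≈ (Snr n r)
  Snr-unique = subst Unique≈ (sym Snr≡)
    (SetoidUniqueₚ.cartesianProduct⁺ (Fin n →-setoid Fin n) (Fin n →-setoid Fin r)
      (SetoidUniqueₚ.filter⁺ (Fin n →-setoid Fin n) isPerm? (allFuns-unique n n)) (allFuns-unique n r))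

  ∈-Snr⁻ : ∀ {σ} → σ ∈ Snr n r → Valid σ
  ∈-Snr⁻ σ∈ with ∈-cartesianProductWith⁻ _,_ (perms n) (allFuns n r) (subst (_ ∈_) Snr≡ σ∈)
  ... | ω , τ , ω∈ , _ , refl = toWitness (proj₂ (∈-filter⁻ isPerm? {xs = allFuns n n} ω∈))

  ∈-Snr⁺ : ∀ {σ} → Valid σ → σ ∈≈ Snr n r
  ∈-Snr⁺ {ω , τ} valid = subst (_ ∈≈_) (sym Snr≡)
    (SetoidMembershipₚ.∈-cartesianProductWith⁺ (Fin n →-setoid Fin n) (Fin n →-setoid Fin r) CPₛ _,_
      (SetoidMembershipₚ.∈-filter⁺ (Fin n →-setoid Fin n) isPerm? isPerm-resp (∈-allFuns n n ω) (fromWitness valid))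
      (∈-allFuns n r τ))
    where
    isPerm-resp : ∀ {ω ω′} → (∀ i → ω i ≡ ω′ i) → T ⌊ injective? ω ⌋ → T ⌊ injective? ω′ ⌋
    isPerm-resp ω≗ω′ p = fromWitness (Valid-resp {_ , τ} {_ , τ} (ω≗ω′ , λ _ → refl) (toWitness p))

  open Averaging _≈_ (Snr n r) public using (SumPreserving)

  record IsSymmetry (g : ColPerm n r → ColPerm n r) : Set where
    field
      cong≈         : g Preserves _≈_ ⟶ _≈_
      sumPreserving : SumPreserving g

  id-isSymmetry : IsSymmetry id
  id-isSymmetry = record { cong≈ = id ; sumPreserving = λ _ _ → refl }

  ∘-isSymmetry : ∀ {g h} → IsSymmetry g → IsSymmetry h → IsSymmetry (g ∘ h)
  ∘-isSymmetry {g} {h} G H = record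
    { cong≈         = G.cong≈ ∘ H.cong≈
    ; sumPreserving = λ f f-resp → trans (H.sumPreserving (f ∘ g) (f-resp ∘ G.cong≈)) (G.sumPreserving f f-resp)
    }
    where
    module G = IsSymmetry G
    module H = IsSymmetry H

  involution-isSymmetry : (g : ColPerm n r → ColPerm n r) → g Preserves _≈_ ⟶ _≈_ →
    (∀ σ → g (g σ) ≈ σ) → (∀ σ → Valid σ → Valid (g σ)) → IsSymmetry g
  involution-isSymmetry g g-cong g-involutive g-valid = record
    { cong≈         = g-cong
    ; sumPreserving = λ f f-resp → trans (sym (sumBy-map g (Snr n r) f))
        (DuplicateFreeSums.sumBy-sameElements CPₛ _≈?_ image-unique Snr-unique image⊆ ⊆image f f-resp)
    }
    where
    g-injective : ∀ {σ σ′} → g σ ≈ g σ′ → σ ≈ σ′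
    g-injective gσ≈gσ′ = ≈-trans (≈-sym (g-involutive _)) (≈-trans (g-cong gσ≈gσ′) (g-involutive _))

    image-unique : Unique≈ (map g (Snr n r))
    image-unique = SetoidUniqueₚ.map⁺ CPₛ CPₛ g-injective Snr-unique

    image⊆ : ∀ {σ} → σ ∈ map g (Snr n r) → σ ∈≈ Snr n r
    image⊆ σ∈ with ∈-map⁻ g σ∈
    ... | ρ , ρ∈ , refl = ∈-Snr⁺ (g-valid ρ (∈-Snr⁻ ρ∈))

    ⊆image : ∀ {σ} → σ ∈ Snr n r → σ ∈≈ map g (Snr n r)
    ⊆image {σ} σ∈ = SetoidMembershipₚ.∈-resp-≈ CPₛ (g-involutive σ)
      (SetoidMembershipₚ.∈-map⁺ CPₛ CPₛ g-cong (∈-Snr⁺ (g-valid σ (∈-Snr⁻ σ∈))))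

module Symmetries (n r′ : ℕ) where

  open ColouredPermutations n (suc r′) public

  CP : Set
  CP = ColPerm n (suc r′)

  letter : CP → Fin n → Symbol
  letter σ x = toℕ (proj₂ σ x) , suc (toℕ (proj₁ σ x))

  sentinel : Symbol
  sentinel = 0 , suc n

  letter-injective : ∀ σ → Valid σ → ∀ {x y} → letter σ x ≡ letter σ y → x ≡ y
  letter-injective σ valid eq = Fin.toℕ-injective (valid _ _ (suc-injective (cong proj₂ eq)))

  sentinel<letter⇒colour≢0 : ∀ σ x → sentinel <ˢ letter σ x → proj₂ σ x ≢ fzero
  sentinel<letter⇒colour≢0 σ x (inj₁ 0<c) c≡0 = <-irrefl refl (subst (λ c → 0 < toℕ c) c≡0 0<c)
  sentinel<letter⇒colour≢0 σ x (inj₂ (_ , n<v)) _ = <-asym n<v (s≤s (Fin.toℕ<n (proj₁ σ x)))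

  colour≢0⇒sentinel<letter : ∀ σ x → proj₂ σ x ≢ fzero → sentinel <ˢ letter σ x
  colour≢0⇒sentinel<letter σ x c≢0 with proj₂ σ x
  ... | fzero  = ⊥-elim (c≢0 refl)
  ... | fsuc _ = inj₁ (s≤s z≤n)

  swapPositions : Fin n → Fin n → CP → CP
  swapPositions p q σ = proj₁ σ ∘ transpose p q , proj₂ σ ∘ transpose p q

  recolour : Fin n → Fin (suc r′) → CP → CP
  recolour p c σ = proj₁ σ , updateAt (proj₂ σ) p (transpose c fzero)

  swapPositions-valid : ∀ p q σ → Valid σ → Valid (swapPositions p q σ)
  swapPositions-valid p q σ valid i j eq =
    cong toℕ (transpose-injective p q (Fin.toℕ-injective (valid _ _ eq)))

  swapPositions-isSymmetry : ∀ p q → IsSymmetry (swapPositions p q)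
  swapPositions-isSymmetry p q = involution-isSymmetry (swapPositions p q)
    (λ (ω≗ , τ≗) → ω≗ ∘ transpose p q , τ≗ ∘ transpose p q)
    (λ σ → (λ i → cong (proj₁ σ) (transpose-involutive p q i)) , (λ i → cong (proj₂ σ) (transpose-involutive p q i)))
    (swapPositions-valid p q)

  recolour-isSymmetry : ∀ p c → IsSymmetry (recolour p c)
  recolour-isSymmetry p c = involution-isSymmetry (recolour p c)
    (λ (ω≗ , τ≗) → ω≗ , updateAt-congˡ p (transpose c fzero) τ≗)
    (λ σ → (λ _ → refl) , λ i → trans
      (updateAt-updateAt-local p (proj₂ σ) (transpose-involutive c fzero (proj₂ σ p)) i) (updateAt-id p (proj₂ σ) i))
    (λ _ valid → valid)

  recolour-colour : ∀ p c σ → proj₂ (recolour p c σ) p ≡ transpose c fzero (proj₂ σ p)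
  recolour-colour p c σ = updateAt-updates p (proj₂ σ)

  recolour-letter-other : ∀ p c σ {x} → x ≢ p → letter (recolour p c σ) x ≡ letter σ x
  recolour-letter-other p c σ {x} x≢p = cong (λ col → toℕ col , _) (updateAt-minimal x p (proj₂ σ) x≢p)

  record IsSubmonoid (Pr : (CP → CP) → Set) : Set where
    field
      id∈ : Pr id
      ∘∈  : ∀ {a b} → Pr a → Pr b → Pr (a ∘ b)

  -- For distinct positions T, one map for each of the |T|! rearrangements of the letters in T.
  shuffles : List (Fin n) → List (CP → CP)
  shuffles []       = id ∷ []
  shuffles (q ∷ qs) = cartesianProductWith (λ p a → a ∘ swapPositions q p) (q ∷ qs) (shuffles qs)

  recolourings : List (Fin n) → List (CP → CP)
  recolourings []       = id ∷ []
  recolourings (q ∷ qs) = cartesianProductWith (λ c a → a ∘ recolour q c) (allFin (suc r′)) (recolourings qs)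

  moves : List (Fin n) → List (CP → CP)
  moves T = cartesianProductWith (λ c a → a ∘ c) (recolourings T) (shuffles T)

  module _ {Pr : (CP → CP) → Set} (submonoid : IsSubmonoid Pr) where
    open IsSubmonoid submonoid

    shuffles-ind : ∀ T → (∀ {p q} → p ∈ T → q ∈ T → Pr (swapPositions p q)) → ∀ {a} → a ∈ shuffles T → Pr a
    shuffles-ind []       swaps (here refl) = id∈
    shuffles-ind (q ∷ qs) swaps a∈ with ∈-cartesianProductWith⁻ _ (q ∷ qs) (shuffles qs) a∈
    ... | p , a , p∈ , a∈′ , refl =
      ∘∈ (shuffles-ind qs (λ x∈ y∈ → swaps (there x∈) (there y∈)) a∈′) (swaps (here refl) p∈)

    recolourings-ind : ∀ T → (∀ {p} c → p ∈ T → Pr (recolour p c)) → ∀ {a} → a ∈ recolourings T → Pr a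
    recolourings-ind []       recolours (here refl) = id∈
    recolourings-ind (q ∷ qs) recolours a∈ with ∈-cartesianProductWith⁻ _ (allFin (suc r′)) (recolourings qs) a∈
    ... | c , a , _ , a∈′ , refl =
      ∘∈ (recolourings-ind qs (λ c x∈ → recolours c (there x∈)) a∈′) (recolours c (here refl))

    moves-ind : ∀ T → (∀ {p q} → p ∈ T → q ∈ T → Pr (swapPositions p q)) → (∀ {p} c → p ∈ T → Pr (recolour p c)) →
      ∀ {g} → g ∈ moves T → Pr g
    moves-ind T swaps recolours g∈ with ∈-cartesianProductWith⁻ _ (recolourings T) (shuffles T) g∈
    ... | c , a , c∈ , a∈ , refl = ∘∈ (shuffles-ind T swaps a∈) (recolourings-ind T recolours c∈)

  moves-isSymmetry : ∀ T {g} → g ∈ moves T → IsSymmetry g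
  moves-isSymmetry T = moves-ind {IsSymmetry} (record { id∈ = id-isSymmetry ; ∘∈ = ∘-isSymmetry }) T
    (λ {p} {q} _ _ → swapPositions-isSymmetry p q) (λ {p} c _ → recolour-isSymmetry p c)

  PreservesValidity : (CP → CP) → Set
  PreservesValidity a = ∀ σ → Valid σ → Valid (a σ)

  preservesValidity-isSubmonoid : IsSubmonoid PreservesValidity
  preservesValidity-isSubmonoid = record { id∈ = λ _ valid → valid ; ∘∈ = λ a b σ valid → a _ (b σ valid) }

  recolourings-valid : ∀ T {a} → a ∈ recolourings T → PreservesValidity a
  recolourings-valid T = recolourings-ind preservesValidity-isSubmonoid T (λ _ _ _ valid → valid)

  FixesOutside : List (Fin n) → (CP → CP) → Set
  FixesOutside T a = ∀ σ {z} → ¬ z ∈ T → letter (a σ) z ≡ letter σ z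

  fixesOutside-isSubmonoid : ∀ T → IsSubmonoid (FixesOutside T)
  fixesOutside-isSubmonoid T = record { id∈ = λ _ _ → refl ; ∘∈ = λ a b σ z∉ → trans (a _ z∉) (b σ z∉) }

  private
    ∉⇒≢ : ∀ {T : List (Fin n)} {p z} → p ∈ T → ¬ z ∈ T → z ≢ p
    ∉⇒≢ p∈ z∉ refl = z∉ p∈

  swapPositions-fixesOutside : ∀ {T p q} → p ∈ T → q ∈ T → FixesOutside T (swapPositions p q)
  swapPositions-fixesOutside p∈ q∈ σ z∉ = cong (letter σ) (transpose-other _ _ (∉⇒≢ p∈ z∉) (∉⇒≢ q∈ z∉))

  recolour-fixesOutside : ∀ {T p} c → p ∈ T → FixesOutside T (recolour p c)
  recolour-fixesOutside c p∈ σ z∉ = recolour-letter-other _ c σ (∉⇒≢ p∈ z∉)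

  shuffles-fixesOutside : ∀ T {a} → a ∈ shuffles T → FixesOutside T a
  shuffles-fixesOutside T = shuffles-ind (fixesOutside-isSubmonoid T) T swapPositions-fixesOutside

  recolourings-fixesOutside : ∀ T {a} → a ∈ recolourings T → FixesOutside T a
  recolourings-fixesOutside T = recolourings-ind (fixesOutside-isSubmonoid T) T recolour-fixesOutside

  moves-fixesOutside : ∀ T {g} → g ∈ moves T → FixesOutside T g
  moves-fixesOutside T = moves-ind (fixesOutside-isSubmonoid T) T swapPositions-fixesOutside recolour-fixesOutside

-- Sorting the letters of a set of positions

module DecreasingTails (n r′ : ℕ) where

  open Symmetries n r′ public

  nextLetter : CP → List (Fin n) → Symbol
  nextLetter σ []      = sentinel
  nextLetter σ (x ∷ _) = letter σ x

  Decreasing : List (Fin n) → CP → Set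
  Decreasing []       σ = ⊤
  Decreasing (q ∷ qs) σ = nextLetter σ qs <ˢ letter σ q × Decreasing qs σ

  decreasing? : ∀ T σ → Dec (Decreasing T σ)
  decreasing? []       σ = yes tt
  decreasing? (q ∷ qs) σ = (nextLetter σ qs <ˢ? letter σ q) ×-dec decreasing? qs σ

  AboveSentinel : List (Fin n) → CP → Set
  AboveSentinel T σ = All (λ x → sentinel <ˢ letter σ x) T

  aboveSentinel? : ∀ T σ → Dec (AboveSentinel T σ)
  aboveSentinel? T σ = All.all? (λ x → sentinel <ˢ? letter σ x) T

  BoundedBy : Symbol → List (Fin n) → CP → Set
  BoundedBy s qs σ = sentinel <ˢ s × All (λ x → letter σ x <ˢ s) qs

  boundedBy? : ∀ s qs σ → Dec (BoundedBy s qs σ)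
  boundedBy? s qs σ = (sentinel <ˢ? s) ×-dec All.all? (λ x → letter σ x <ˢ? s) qs

  StrictMaximum : CP → List (Fin n) → Fin n → Set
  StrictMaximum σ T p = ∀ {y} → y ∈ T → y ≢ p → letter σ y <ˢ letter σ p

  bounded⇒nextLetter< : ∀ {s} qs σ → BoundedBy s qs σ → nextLetter σ qs <ˢ s
  bounded⇒nextLetter< []      σ (sentinel<s , _) = sentinel<s
  bounded⇒nextLetter< (x ∷ _) σ (_ , x<s ∷ _)   = x<s

  decreasing⇒bounded : ∀ {s} qs σ → Decreasing qs σ → nextLetter σ qs <ˢ s → BoundedBy s qs σ
  decreasing⇒bounded []       σ _             sentinel<s = sentinel<s , []
  decreasing⇒bounded (x ∷ xs) σ (next<x , xs↓) x<s
    with decreasing⇒bounded xs σ xs↓ (<ˢ-trans next<x x<s)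
  ... | sentinel<s , xs<s = sentinel<s , x<s ∷ xs<s

  shuffles-boundedBy : ∀ qs {a} → a ∈ shuffles qs → ∀ s σ → BoundedBy s qs (a σ) ⇔ BoundedBy s qs σ
  shuffles-boundedBy qs = shuffles-ind {λ a → ∀ s σ → BoundedBy s qs (a σ) ⇔ BoundedBy s qs σ}
    (record { id∈ = λ _ _ → ⇔-id _ ; ∘∈ = λ {a} {b} a⇔ b⇔ s σ → b⇔ s σ ⇔-∘ a⇔ s (b σ) }) qs
    (λ {p} {q} p∈ q∈ s σ → mk⇔
      (λ (sentinel<s , qs<s) → sentinel<s , All.tabulate λ {x} x∈ →
        subst (λ z → letter σ z <ˢ s) (transpose-involutive p q x) (All.lookup qs<s (∈-transpose p q p∈ q∈ x∈)))
      (λ (sentinel<s , qs<s) → sentinel<s , All.tabulate λ x∈ → All.lookup qs<s (∈-transpose p q p∈ q∈ x∈)))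

  decreasing-∷-shuffle : ∀ q qs → ¬ q ∈ qs → ∀ σ {a} → a ∈ shuffles qs →
    indicator (decreasing? (q ∷ qs) (a σ)) ≡ indicator (boundedBy? (letter σ q) qs σ) * indicator (decreasing? qs (a σ))
  decreasing-∷-shuffle q qs q∉qs σ {a} a∈ =
    trans (indicator-cong (decreasing? (q ∷ qs) (a σ)) (boundedBy? (letter σ q) qs σ ×-dec decreasing? qs (a σ)) (mk⇔ to from))
          (indicator-× (boundedBy? (letter σ q) qs σ) (decreasing? qs (a σ)))
    where
    fixed : letter (a σ) q ≡ letter σ q
    fixed = shuffles-fixesOutside qs a∈ σ q∉qs
    bounds : BoundedBy (letter σ q) qs (a σ) ⇔ BoundedBy (letter σ q) qs σ
    bounds = shuffles-boundedBy qs a∈ (letter σ q) σ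
    to : Decreasing (q ∷ qs) (a σ) → BoundedBy (letter σ q) qs σ × Decreasing qs (a σ)
    to (next<q , qs↓) =
      Equivalence.to bounds (decreasing⇒bounded qs (a σ) qs↓ (subst (nextLetter (a σ) qs <ˢ_) fixed next<q)) , qs↓
    from : BoundedBy (letter σ q) qs σ × Decreasing qs (a σ) → Decreasing (q ∷ qs) (a σ)
    from (bounded , qs↓) =
      subst (nextLetter (a σ) qs <ˢ_) (sym fixed) (bounded⇒nextLetter< qs (a σ) (Equivalence.from bounds bounded)) , qs↓

  module _ {q : Fin n} {qs : List (Fin n)} (q∉qs : ¬ q ∈ qs) {p : Fin n} (p∈ : p ∈ q ∷ qs) where

    transpose-others : ∀ {y} → y ∈ q ∷ qs → y ≢ p → transpose q p y ∈ qs
    transpose-others y∈ y≢p with ∈-transpose q p (here refl) p∈ y∈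
    ... | here ty≡q = ⊥-elim (y≢p (transpose≡ˡ⇒≡ʳ q p ty≡q))
    ... | there ty∈ = ty∈

    transpose-avoids : ∀ {x} → x ∈ qs → transpose q p x ≢ p
    transpose-avoids x∈ tx≡p = q∉qs (subst (_∈ qs) (transpose≡ʳ⇒≡ˡ q p tx≡p) x∈)

    boundedBy-swap⇔ : ∀ σ → BoundedBy (letter σ p) qs (swapPositions q p σ)
                          ⇔ (sentinel <ˢ letter σ p × StrictMaximum σ (q ∷ qs) p)
    boundedBy-swap⇔ σ = mk⇔
      (λ (sentinel<p , qs<p) → sentinel<p , λ y∈ y≢p →
        subst (λ z → letter σ z <ˢ letter σ p) (transpose-involutive q p _) (All.lookup qs<p (transpose-others y∈ y≢p)))
      (λ (sentinel<p , p-max) → sentinel<p , All.tabulate λ x∈ →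
        p-max (∈-transpose q p (here refl) p∈ (there x∈)) (transpose-avoids x∈))

    aboveSentinel-swap : ∀ σ → AboveSentinel (q ∷ qs) σ → AboveSentinel qs (swapPositions q p σ)
    aboveSentinel-swap σ above = All.tabulate λ x∈ → All.lookup above (∈-transpose q p (here refl) p∈ (there x∈))

    aboveSentinel-unswap : ∀ σ → sentinel <ˢ letter σ p → AboveSentinel qs (swapPositions q p σ) → AboveSentinel (q ∷ qs) σ
    aboveSentinel-unswap σ sentinel<p above = All.tabulate λ {y} y∈ → by-cases y∈ (y Fin.≟ p)
      where
      by-cases : ∀ {y} → y ∈ q ∷ qs → Dec (y ≡ p) → sentinel <ˢ letter σ y
      by-cases _  (yes refl) = sentinel<p
      by-cases y∈ (no y≢p)   =
        subst (λ z → sentinel <ˢ letter σ z) (transpose-involutive q p _) (All.lookup above (transpose-others y∈ y≢p))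

  strictMaximum-unique : ∀ σ T {p p′} → p ∈ T → p′ ∈ T → StrictMaximum σ T p → StrictMaximum σ T p′ → p ≡ p′
  strictMaximum-unique σ T {p} {p′} p∈ p′∈ p-max p′-max with p Fin.≟ p′
  ... | yes p≡p′ = p≡p′
  ... | no  p≢p′ = ⊥-elim (<ˢ-asym (p′-max p∈ p≢p′) (p-max p′∈ (p≢p′ ∘ sym)))

  strictMaximum-exists : ∀ σ → Valid σ → ∀ q qs → ∃ λ p → p ∈ q ∷ qs × StrictMaximum σ (q ∷ qs) p
  strictMaximum-exists σ valid q qs with maximum-exists (letter σ) q qs
  ... | p , p∈ , p-max = p , p∈ , λ y∈ y≢p → strict (p-max y∈) y≢p
    where
    strict : ∀ {y} → letter σ y ≡ letter σ p ⊎ letter σ y <ˢ letter σ p → y ≢ p → letter σ y <ˢ letter σ p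
    strict (inj₁ same) y≢p = ⊥-elim (y≢p (letter-injective σ valid same))
    strict (inj₂ y<p)  _   = y<p

  sumBy-swaps-maximal : ∀ q qs → Unique (q ∷ qs) → ∀ σ → Valid σ →
    sumBy (q ∷ qs) (λ p → indicator (boundedBy? (letter σ p) qs (swapPositions q p σ))
                          * indicator (aboveSentinel? qs (swapPositions q p σ)))
      ≡ indicator (aboveSentinel? (q ∷ qs) σ)
  sumBy-swaps-maximal q qs distinct σ valid = by-cases (aboveSentinel? (q ∷ qs) σ)
    where
    q∉qs : ¬ q ∈ qs
    q∉qs = Unique[x∷xs]⇒x∉xs distinct
    bounded? : ∀ p → Dec (BoundedBy (letter σ p) qs (swapPositions q p σ))
    bounded? p = boundedBy? (letter σ p) qs (swapPositions q p σ)
    above? : ∀ p → Dec (AboveSentinel qs (swapPositions q p σ))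
    above? p = aboveSentinel? qs (swapPositions q p σ)

    by-cases : (above : Dec (AboveSentinel (q ∷ qs) σ)) →
      sumBy (q ∷ qs) (λ p → indicator (bounded? p) * indicator (above? p)) ≡ indicator above
    by-cases (no ¬above) = sumBy-zero (q ∷ qs) λ {p} p∈ → indicator-*-≡0 (bounded? p) (above? p)
      λ bounded above → ¬above (aboveSentinel-unswap q∉qs p∈ σ (proj₁ bounded) above)
    by-cases (yes above) with strictMaximum-exists σ valid q qs
    ... | p₀ , p₀∈ , p₀-max = trans
      (sumBy-cong (q ∷ qs) λ {p} p∈ →
        trans (cong (indicator (bounded? p) *_) (indicator-yes (above? p) (aboveSentinel-swap q∉qs p∈ σ above)))
              (*-identityʳ _))
      (DuplicateFreeSums.sumBy-indicator-unique (setoid (Fin n)) bounded? distinct p₀∈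
        (Equivalence.from (boundedBy-swap⇔ q∉qs p₀∈ σ) (All.lookup above p₀∈ , p₀-max))
        λ p∈ bounded → strictMaximum-unique σ (q ∷ qs) p∈ p₀∈
                         (proj₂ (Equivalence.to (boundedBy-swap⇔ q∉qs p∈ σ) bounded)) p₀-max)

  -- The first swap must bring the largest letter to the front, and then the rest is sorted recursively.
  sumBy-shuffles-decreasing : ∀ T → Unique T → ∀ σ → Valid σ →
    sumBy (shuffles T) (λ a → indicator (decreasing? T (a σ))) ≡ indicator (aboveSentinel? T σ)
  sumBy-shuffles-decreasing []       _                      σ _     = refl
  sumBy-shuffles-decreasing (q ∷ qs) distinct@(_ ∷ qs!) σ valid = begin
    sumBy (shuffles (q ∷ qs)) (λ a → indicator (decreasing? (q ∷ qs) (a σ)))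
      ≡⟨ sumBy-cartesianProductWith _ (q ∷ qs) (shuffles qs) _ ⟩
    sumBy (q ∷ qs) (λ p → sumBy (shuffles qs) (λ a → indicator (decreasing? (q ∷ qs) (a (σ↔ p)))))
      ≡⟨ sumBy-cong (q ∷ qs) (λ {p} _ → sort-rest p) ⟩
    sumBy (q ∷ qs) (λ p → indicator (boundedBy? (letter σ p) qs (σ↔ p)) * indicator (aboveSentinel? qs (σ↔ p)))
      ≡⟨ sumBy-swaps-maximal q qs distinct σ valid ⟩
    indicator (aboveSentinel? (q ∷ qs) σ)  ∎
    where
    open ≡-Reasoning
    σ↔ : Fin n → CP
    σ↔ p = swapPositions q p σ

    sort-rest : ∀ p → sumBy (shuffles qs) (λ a → indicator (decreasing? (q ∷ qs) (a (σ↔ p))))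
                    ≡ indicator (boundedBy? (letter σ p) qs (σ↔ p)) * indicator (aboveSentinel? qs (σ↔ p))
    sort-rest p = begin
      sumBy (shuffles qs) (λ a → indicator (decreasing? (q ∷ qs) (a (σ↔ p))))
        ≡⟨ sumBy-cong (shuffles qs) (decreasing-∷-shuffle q qs (Unique[x∷xs]⇒x∉xs distinct) (σ↔ p)) ⟩
      sumBy (shuffles qs) (λ a → indicator (boundedBy? (letter (σ↔ p) q) qs (σ↔ p)) * indicator (decreasing? qs (a (σ↔ p))))
        ≡⟨ sumBy-*ˡ (shuffles qs) (indicator (boundedBy? (letter (σ↔ p) q) qs (σ↔ p)))
                    (λ a → indicator (decreasing? qs (a (σ↔ p)))) ⟩
      indicator (boundedBy? (letter (σ↔ p) q) qs (σ↔ p)) * sumBy (shuffles qs) (λ a → indicator (decreasing? qs (a (σ↔ p))))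
        ≡⟨ cong₂ _*_ (cong (λ s → indicator (boundedBy? s qs (σ↔ p))) (cong (letter σ) (transpose-matchˡ q p)))
                     (sumBy-shuffles-decreasing qs qs! (σ↔ p) (swapPositions-valid q p σ valid)) ⟩
      indicator (boundedBy? (letter σ p) qs (σ↔ p)) * indicator (aboveSentinel? qs (σ↔ p))  ∎

  recolour-aboveSentinel⇔ : ∀ q c σ → sentinel <ˢ letter (recolour q c σ) q ⇔ c ≢ proj₂ σ q
  recolour-aboveSentinel⇔ q c σ = mk⇔
    (λ sentinel< c≡ → sentinel<letter⇒colour≢0 (recolour q c σ) q sentinel<
      (trans (recolour-colour q c σ) (trans (cong (transpose c fzero) (sym c≡)) (transpose-matchˡ c fzero))))
    (λ c≢ → colour≢0⇒sentinel<letter (recolour q c σ) q λ colour≡0 →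
      c≢ (sym (transpose≡ʳ⇒≡ˡ c fzero (trans (sym (recolour-colour q c σ)) colour≡0))))

  aboveSentinel-∷ : ∀ q qs σ →
    indicator (aboveSentinel? (q ∷ qs) σ) ≡ indicator (sentinel <ˢ? letter σ q) * indicator (aboveSentinel? qs σ)
  aboveSentinel-∷ q qs σ = trans
    (indicator-cong (aboveSentinel? (q ∷ qs) σ) ((sentinel <ˢ? letter σ q) ×-dec aboveSentinel? qs σ)
      (mk⇔ (λ { (x ∷ xs) → x , xs }) (λ (x , xs) → x ∷ xs)))
    (indicator-× (sentinel <ˢ? letter σ q) (aboveSentinel? qs σ))

  sumBy-recolourings-aboveSentinel : ∀ T → Unique T → ∀ σ →
    sumBy (recolourings T) (λ a → indicator (aboveSentinel? T (a σ))) ≡ r′ ^ length T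
  sumBy-recolourings-aboveSentinel []       _             σ = refl
  sumBy-recolourings-aboveSentinel (q ∷ qs) distinct@(_ ∷ qs!) σ = begin
    sumBy (recolourings (q ∷ qs)) (λ a → indicator (aboveSentinel? (q ∷ qs) (a σ)))
      ≡⟨ sumBy-cartesianProductWith _ colours (recolourings qs) _ ⟩
    sumBy colours (λ c → sumBy (recolourings qs) (λ a → indicator (aboveSentinel? (q ∷ qs) (a (σ↺ c)))))
      ≡⟨ sumBy-cong colours (λ {c} _ → colour-rest c) ⟩
    sumBy colours (λ c → r′ ^ length qs * indicator (¬? (c Fin.≟ proj₂ σ q)))
      ≡⟨ sumBy-*ˡ colours (r′ ^ length qs) (λ c → indicator (¬? (c Fin.≟ proj₂ σ q))) ⟩
    r′ ^ length qs * sumBy colours (λ c → indicator (¬? (c Fin.≟ proj₂ σ q)))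
      ≡⟨ cong (r′ ^ length qs *_) (sumBy-allFin-≢ r′ (proj₂ σ q)) ⟩
    r′ ^ length qs * r′
      ≡⟨ *-comm (r′ ^ length qs) r′ ⟩
    r′ ^ length (q ∷ qs)  ∎
    where
    open ≡-Reasoning
    colours : List (Fin (suc r′))
    colours = allFin (suc r′)
    σ↺ : Fin (suc r′) → CP
    σ↺ c = recolour q c σ

    colour-rest : ∀ c → sumBy (recolourings qs) (λ a → indicator (aboveSentinel? (q ∷ qs) (a (σ↺ c))))
                      ≡ r′ ^ length qs * indicator (¬? (c Fin.≟ proj₂ σ q))
    colour-rest c = begin
      sumBy (recolourings qs) (λ a → indicator (aboveSentinel? (q ∷ qs) (a (σ↺ c))))
        ≡⟨ sumBy-cong (recolourings qs) (λ {a} a∈ → trans (aboveSentinel-∷ q qs (a (σ↺ c)))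
             (cong (λ s → indicator (sentinel <ˢ? s) * indicator (aboveSentinel? qs (a (σ↺ c))))
                   (recolourings-fixesOutside qs a∈ (σ↺ c) (Unique[x∷xs]⇒x∉xs distinct)))) ⟩
      sumBy (recolourings qs) (λ a → indicator (sentinel <ˢ? letter (σ↺ c) q) * indicator (aboveSentinel? qs (a (σ↺ c))))
        ≡⟨ sumBy-*ˡ (recolourings qs) (indicator (sentinel <ˢ? letter (σ↺ c) q))
                    (λ a → indicator (aboveSentinel? qs (a (σ↺ c)))) ⟩
      indicator (sentinel <ˢ? letter (σ↺ c) q) * sumBy (recolourings qs) (λ a → indicator (aboveSentinel? qs (a (σ↺ c))))
        ≡⟨ cong₂ _*_ (indicator-cong (sentinel <ˢ? letter (σ↺ c) q) (¬? (c Fin.≟ proj₂ σ q)) (recolour-aboveSentinel⇔ q c σ))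
                     (sumBy-recolourings-aboveSentinel qs qs! (σ↺ c)) ⟩
      indicator (¬? (c Fin.≟ proj₂ σ q)) * r′ ^ length qs
        ≡⟨ *-comm _ (r′ ^ length qs) ⟩
      r′ ^ length qs * indicator (¬? (c Fin.≟ proj₂ σ q))  ∎

  orbit-count : ∀ T → Unique T → ∀ σ → Valid σ →
    sumBy (moves T) (λ g → indicator (decreasing? T (g σ))) ≡ r′ ^ length T
  orbit-count T T! σ valid = begin
    sumBy (moves T) (λ g → indicator (decreasing? T (g σ)))
      ≡⟨ sumBy-cartesianProductWith _ (recolourings T) (shuffles T) _ ⟩
    sumBy (recolourings T) (λ c → sumBy (shuffles T) (λ a → indicator (decreasing? T (a (c σ)))))
      ≡⟨ sumBy-cong (recolourings T) (λ {c} c∈ → sumBy-shuffles-decreasing T T! (c σ) (recolourings-valid T c∈ σ valid)) ⟩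
    sumBy (recolourings T) (λ c → indicator (aboveSentinel? T (c σ)))
      ≡⟨ sumBy-recolourings-aboveSentinel T T! σ ⟩
    r′ ^ length T  ∎
    where open ≡-Reasoning

  moves-nonEmpty : ∀ T → NonZero (length (moves T))
  moves-nonEmpty T = subst NonZero (sym (length-cartesianProductWith _ (recolourings T) (shuffles T)))
    (m*n≢0 _ _ {{recolourings-nonEmpty T}} {{shuffles-nonEmpty T}})
    where
    shuffles-nonEmpty : ∀ T → NonZero (length (shuffles T))
    shuffles-nonEmpty []       = _
    shuffles-nonEmpty (q ∷ qs) = subst NonZero (sym (length-cartesianProductWith _ (q ∷ qs) (shuffles qs)))
      (m*n≢0 (length (q ∷ qs)) _ {{_}} {{shuffles-nonEmpty qs}})
    recolourings-nonEmpty : ∀ T → NonZero (length (recolourings T))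
    recolourings-nonEmpty []       = _
    recolourings-nonEmpty (q ∷ qs) = subst NonZero (sym (length-cartesianProductWith _ (allFin (suc r′)) (recolourings qs)))
      (m*n≢0 (length (allFin (suc r′))) _ {{subst NonZero (sym (length-tabulate {n = suc r′} id)) _}} {{recolourings-nonEmpty qs}})

interval : ℕ → ℕ → List ℕ
interval zero    s = []
interval (suc k) s = s ∷ interval k (suc s)

-- range is defined through a local function of Defs, which with-abstraction over n ∸ m makes reduce.
range-interval : ∀ k m n → n ∸ m ≡ k → range m n ≡ interval k (suc m)
range-interval k m n eq with n ∸ m in n∸m≡
range-interval .zero    m n refl | zero  = refl
range-interval .(suc k) m n refl | suc k
  with n ∸ suc m | next-count | range-interval k (suc m) n next-count
  where
  next-count : n ∸ suc m ≡ k
  next-count = trans (sym (pred[m∸n]≡m∸[1+n] n m)) (cong pred n∸m≡)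
... | _ | refl | ih = cong (suc m ∷_) ih

module Descents (n r′ : ℕ) where

  open DecreasingTails n r′ public

  symAt-zero : ∀ σ → symAt {n} {suc r′} σ 0 ≡ sentinel
  symAt-zero σ with 0 ≤? n
  ... | yes _ = refl
  ... | no  _ = refl

  symAt-suc : ∀ σ {k} (k<n : k < n) → symAt {n} {suc r′} σ (suc k) ≡ letter σ (fromℕ< k<n)
  symAt-suc σ {k} k<n with suc k ≤? n
  ... | yes _   = refl
  ... | no  k≮n = ⊥-elim (k≮n k<n)

  symAt-beyond : ∀ σ {i} → n < i → symAt {n} {suc r′} σ i ≡ sentinel
  symAt-beyond σ {i} n<i with i ≤? n
  ... | yes i≤n = ⊥-elim (<⇒≱ n<i i≤n)
  ... | no  _   = refl

  symAt-below : ∀ σ σ′ {m} → (∀ x → toℕ x < m → letter σ x ≡ letter σ′ x) →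
    ∀ {i} → i ≤ m → symAt {n} {suc r′} σ i ≡ symAt σ′ i
  symAt-below σ σ′ same {zero}  _   = trans (symAt-zero σ) (sym (symAt-zero σ′))
  symAt-below σ σ′ {m} same {suc k} k<m = by-cases (k <? n)
    where
    by-cases : Dec (k < n) → symAt {n} {suc r′} σ (suc k) ≡ symAt σ′ (suc k)
    by-cases (yes k<n) = trans (symAt-suc σ k<n)
      (trans (same _ (subst (_< m) (sym (Fin.toℕ-fromℕ< k<n)) k<m)) (sym (symAt-suc σ′ k<n)))
    by-cases (no  k≮n) = trans (symAt-beyond σ (s≤s (≮⇒≥ k≮n))) (sym (symAt-beyond σ′ (s≤s (≮⇒≥ k≮n))))

  symAt-letters : ∀ σ σ′ → (∀ x → letter σ x ≡ letter σ′ x) → ∀ i → symAt {n} {suc r′} σ i ≡ symAt σ′ i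
  symAt-letters σ σ′ same i = symAt-below σ σ′ (λ x _ → same x) (≤-refl {i})

  descents? : ∀ is σ → Dec (All (IsDescent {n} {suc r′} σ) is)
  descents? is σ = All.all? (isDescent? σ) is

  descentIndicator : List ℕ → CP → ℕ
  descentIndicator is σ = indicator (descents? is σ)

  descentIndicator-++ : ∀ as bs σ → descentIndicator (as ++ bs) σ ≡ descentIndicator as σ * descentIndicator bs σ
  descentIndicator-++ as bs σ = trans
    (indicator-cong (descents? (as ++ bs) σ) (descents? as σ ×-dec descents? bs σ)
      (mk⇔ (Allₚ.++⁻ as) (λ (p , q) → Allₚ.++⁺ p q)))
    (indicator-× (descents? as σ) (descents? bs σ))

  descentIndicator-symAt : ∀ is σ σ′ →
    (∀ {i} → i ∈ is → symAt {n} {suc r′} σ (suc i) ≡ symAt σ′ (suc i) × symAt {n} {suc r′} σ i ≡ symAt σ′ i) →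
    descentIndicator is σ ≡ descentIndicator is σ′
  descentIndicator-symAt is σ σ′ same = indicator-cong (descents? is σ) (descents? is σ′) (mk⇔
    (λ ds → All.tabulate λ i∈ → subst₂ _<ˢ_ (proj₁ (same i∈)) (proj₂ (same i∈)) (All.lookup ds i∈))
    (λ ds → All.tabulate λ i∈ → subst₂ _<ˢ_ (sym (proj₁ (same i∈))) (sym (proj₂ (same i∈))) (All.lookup ds i∈)))

  descentIndicator-cong : ∀ is → descentIndicator is Preserves _≈_ ⟶ _≡_
  descentIndicator-cong is {σ} {σ′} (ω≗ , τ≗) = descentIndicator-symAt is σ σ′ λ {i} _ → same (suc i) , same i
    where
    same : ∀ i → symAt {n} {suc r′} σ i ≡ symAt σ′ i
    same = symAt-letters σ σ′ λ x → cong₂ (λ c v → toℕ c , suc (toℕ v)) (τ≗ x) (ω≗ x)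

  moves-fix-head : ∀ {m} T → (∀ {x} → x ∈ T → m ≤ toℕ x) → ∀ {g} → g ∈ moves T →
    ∀ as → All (_< m) as → ∀ σ → descentIndicator as (g σ) ≡ descentIndicator as σ
  moves-fix-head {m} T T≥m {g} g∈ as as<m σ = descentIndicator-symAt as (g σ) σ λ i∈ →
    let i<m = All.lookup as<m i∈ in same i<m , same (<⇒≤ i<m)
    where
    same : ∀ {i} → i ≤ m → symAt {n} {suc r′} (g σ) i ≡ symAt σ i
    same = symAt-below (g σ) σ λ x x<m → moves-fixesOutside T g∈ σ λ x∈ → <⇒≱ x<m (T≥m x∈)

  private
    first<n : ∀ j k → j + suc k ≡ n → j < n
    first<n j k j+1+k≡n = subst (j <_) j+1+k≡n (m<m+n j z<s)

    rest-length : ∀ j k → j + suc k ≡ n → suc j + k ≡ n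
    rest-length j k j+1+k≡n = trans (sym (+-suc j k)) j+1+k≡n

  positionsFrom : (j k : ℕ) → j + k ≡ n → List (Fin n)
  positionsFrom j zero    _ = []
  positionsFrom j (suc k) e = fromℕ< (first<n j k e) ∷ positionsFrom (suc j) k (rest-length j k e)

  positionsFrom-≥ : ∀ j k e {x} → x ∈ positionsFrom j k e → j ≤ toℕ x
  positionsFrom-≥ j (suc k) e (here refl) = ≤-reflexive (sym (Fin.toℕ-fromℕ< (first<n j k e)))
  positionsFrom-≥ j (suc k) e (there x∈)  = ≤-trans (n≤1+n j) (positionsFrom-≥ (suc j) k (rest-length j k e) x∈)

  positionsFrom-unique : ∀ j k e → Unique (positionsFrom j k e)
  positionsFrom-unique j zero    e = []
  positionsFrom-unique j (suc k) e =
    All.tabulate (λ y∈ first≡y → <-irrefl (trans (sym (Fin.toℕ-fromℕ< (first<n j k e))) (cong toℕ first≡y))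
                                          (positionsFrom-≥ (suc j) k (rest-length j k e) y∈))
    ∷ positionsFrom-unique (suc j) k (rest-length j k e)

  symAt-nextLetter : ∀ j k e σ → symAt {n} {suc r′} σ (suc j) ≡ nextLetter σ (positionsFrom j k e)
  symAt-nextLetter j zero    e σ = symAt-beyond σ (≤-reflexive (cong suc (sym (trans (sym (+-identityʳ j)) e))))
  symAt-nextLetter j (suc k) e σ = symAt-suc σ (first<n j k e)

  descents⇔decreasing : ∀ j k e σ →
    All (IsDescent {n} {suc r′} σ) (interval k (suc j)) ⇔ Decreasing (positionsFrom j k e) σ
  descents⇔decreasing j zero    e σ = mk⇔ (λ _ → tt) (λ _ → [])
  descents⇔decreasing j (suc k) e σ = mk⇔
    (λ { (d ∷ ds) → subst₂ _<ˢ_ next first d , Equivalence.to rest ds })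
    (λ (d , ds) → subst₂ _<ˢ_ (sym next) (sym first) d ∷ Equivalence.from rest ds)
    where
    e′ : suc j + k ≡ n
    e′ = rest-length j k e
    rest : All (IsDescent {n} {suc r′} σ) (interval k (suc (suc j))) ⇔ Decreasing (positionsFrom (suc j) k e′) σ
    rest = descents⇔decreasing (suc j) k e′ σ
    next : symAt {n} {suc r′} σ (suc (suc j)) ≡ nextLetter σ (positionsFrom (suc j) k e′)
    next = symAt-nextLetter (suc j) k e′ σ
    first : symAt {n} {suc r′} σ (suc j) ≡ letter σ (fromℕ< (first<n j k e))
    first = symAt-suc σ (first<n j k e)

  tail-decreasing : ∀ m → ∃ λ T → Unique T × (∀ {x} → x ∈ T → m ≤ toℕ x) ×
    (∀ σ → descentIndicator (range m n) σ ≡ indicator (decreasing? T σ))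
  tail-decreasing m with m ≤? n
  ... | yes m≤n = positionsFrom m (n ∸ m) e , positionsFrom-unique m (n ∸ m) e , positionsFrom-≥ m (n ∸ m) e ,
    λ σ → trans (cong (λ is → descentIndicator is σ) (range-interval (n ∸ m) m n refl))
                (indicator-cong _ (decreasing? _ σ) (descents⇔decreasing m (n ∸ m) e σ))
    where
    e : m + (n ∸ m) ≡ n
    e = m+[n∸m]≡n m≤n
  ... | no  m≰n = [] , [] , (λ ()) ,
    λ σ → cong (λ is → descentIndicator is σ) (range-interval 0 m n (m≤n⇒m∸n≡0 (<⇒≤ (≰⇒> m≰n))))

ratio-* : ∀ a b c N → c * N ≡ a * b → ratio c N ≡ ratio a N ℚ.* ratio b N
ratio-* a b c zero       _        = refl
ratio-* a b c N@(suc N′) c*N≡a*b = ℚ.toℚᵘ-injective as-unnormalised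
  where
  cross-multiplied : ℤ.+ c ℤ.* ℤ.+ (N * N) ≡ ℤ.+ a ℤ.* ℤ.+ b ℤ.* ℤ.+ N
  cross-multiplied = begin
    ℤ.+ c ℤ.* ℤ.+ (N * N)     ≡⟨ sym (ℤ.pos-* c (N * N)) ⟩
    ℤ.+ (c * (N * N))         ≡⟨ cong ℤ.+_ (trans (sym (*-assoc c N N)) (cong (_* N) c*N≡a*b)) ⟩
    ℤ.+ (a * b * N)           ≡⟨ trans (ℤ.pos-* (a * b) N) (cong (ℤ._* ℤ.+ N) (ℤ.pos-* a b)) ⟩
    ℤ.+ a ℤ.* ℤ.+ b ℤ.* ℤ.+ N ∎
    where open ≡-Reasoning

  as-unnormalised : ℚ.toℚᵘ (ratio c N) ℚᵘ.≃ ℚ.toℚᵘ (ratio a N ℚ.* ratio b N)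
  as-unnormalised = begin
    ℚ.toℚᵘ (ratio c N)                          ≈⟨ ℚ.toℚᵘ-fromℚᵘ (mkℚᵘ (ℤ.+ c) N′) ⟩
    mkℚᵘ (ℤ.+ c) N′                             ≈⟨ *≡* cross-multiplied ⟩
    mkℚᵘ (ℤ.+ a) N′ ℚᵘ.* mkℚᵘ (ℤ.+ b) N′
      ≈⟨ ℚᵘ.*-cong (ℚ.toℚᵘ-fromℚᵘ (mkℚᵘ (ℤ.+ a) N′)) (ℚ.toℚᵘ-fromℚᵘ (mkℚᵘ (ℤ.+ b) N′)) ⟨
    ℚ.toℚᵘ (ratio a N) ℚᵘ.* ℚ.toℚᵘ (ratio b N)  ≈⟨ ℚ.toℚᵘ-homo-* (ratio a N) (ratio b N) ⟨
    ℚ.toℚᵘ (ratio a N ℚ.* ratio b N)            ∎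
    where open ℚᵘ.≃-Reasoning

lemma3p7 : (n r : ℕ) → 1 ≤ n → 1 ≤ r → (m : ℕ) → m ≤ n + 1 →
    (as : List ℕ) → All (λ a → (1 ≤ a) × (a < m)) as →
    E n r (as ++ range m n) ≡ E n r as ℚ.* E n r (range m n)
lemma3p7 n (suc r′) _ _ m _ as as-bounds with Descents.tail-decreasing n r′ m
... | T , T! , T≥m , tail≡ = ratio-* (# as) (# R) (# (as ++ R)) N (begin
  # (as ++ R) * N                                                    ≡⟨ cong (_* N) count-++ ⟩
  sumBy 𝔖 (λ σ → descentIndicator as σ * descentIndicator R σ) * N   ≡⟨ independence ⟩
  sumBy 𝔖 (descentIndicator as) * sumBy 𝔖 (descentIndicator R)       ≡⟨ sym (cong₂ _*_ (count as) (count R)) ⟩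
  # as * # R                                                         ∎)
  where
  open Descents n r′
  open Averaging _≈_ (Snr n (suc r′))
  open ≡-Reasoning
  R : List ℕ
  R = range m n
  𝔖 : List CP
  𝔖 = Snr n (suc r′)
  N : ℕ
  N = length 𝔖
  # : List ℕ → ℕ
  # is = length (filterᵇ (allDescents is) 𝔖)

  count : ∀ is → # is ≡ sumBy 𝔖 (descentIndicator is)
  count is = length-filterᵇ-⌊⌋ (λ σ → All.all? (isDescent? σ) is) 𝔖

  count-++ : # (as ++ R) ≡ sumBy 𝔖 (λ σ → descentIndicator as σ * descentIndicator R σ)
  count-++ = trans (count (as ++ R)) (sumBy-cong 𝔖 (λ {σ} _ → descentIndicator-++ as R σ))

  orbits : ∀ {σ} → σ ∈ 𝔖 → sumBy (moves T) (λ g → descentIndicator R (g σ)) ≡ r′ ^ length T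
  orbits {σ} σ∈ = trans (sumBy-cong (moves T) (λ {g} _ → tail≡ (g σ))) (orbit-count T T! σ (∈-Snr⁻ σ∈))

  head-fixed : ∀ {g} → g ∈ moves T → ∀ σ → descentIndicator as (g σ) ≡ descentIndicator as σ
  head-fixed g∈ = moves-fix-head T T≥m g∈ as (All.map proj₂ as-bounds)

  independence : sumBy 𝔖 (λ σ → descentIndicator as σ * descentIndicator R σ) * N
               ≡ sumBy 𝔖 (descentIndicator as) * sumBy 𝔖 (descentIndicator R)
  independence = independent-by-averaging (moves T) (IsSymmetry.sumPreserving ∘ moves-isSymmetry T)
    (descentIndicator R) (descentIndicator-cong R) (r′ ^ length T) orbits {{moves-nonEmpty T}}
    (descentIndicator as) (descentIndicator-cong as) head-fixed
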